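{- For every $n\in\mathbb{N}$, we have $s(n)\le b(n)$, where $s(n)$ is the minimum number such that every temporal clique with $n$ vertices admits a spanner with at most $s(n)$ edges, and $b(n)$ is the minimum number such that every temporal bi-clique with $n$ vertices on each side admits a bi-spanner with at most $b(n)$ edges.
   Context: A temporal graph is $(V,E,\lambda)$ with $\lambda\colon E\to\mathbb{N}$. A path $v_1\dots v_k$ is temporal if $\lambda(\{v_i,v_{i+1}\})\le\lambda(\{v_{i+1},v_{i+2}\})$ for all $i\in[k-2]$. A temporal clique has a complete underlying graph; a spanner is an edge set $S$ such that every vertex reaches every other vertex by a temporal path within $S$. A temporal bi-clique $(A,B,\lambda)$ has the complete bipartite graph with disjoint parts $A,B$ as underlying graph; a bi-spanner is an edge set $S$ such that every $a\in A$ reaches every $b\in B$ by a temporal path within $S$. -}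

module Defs where

open import Level using (0ℓ)
open import Data.Nat using (ℕ; zero; suc; _≤_)
open import Data.Fin using (Fin)
open import Data.Product using (_×_; _,_; ∃; ∃-syntax)
open import Data.Sum using (_⊎_; inj₁; inj₂)
open import Data.Empty using (⊥)
open import Data.List using (List; []; _∷_; length)
open import Data.List.Membership.Propositional using (_∈_)
open import Data.List.Relation.Unary.All using (All)
open import Data.List.Relation.Unary.Unique.Propositional using (Unique)
open import Relation.Binary.PropositionalEquality using (_≡_; _≢_)

-- A graph is given by a vertex type V, an edge relation E (the edges
-- available, i.e. those of the chosen edge set S) and a labelling lab.
-- 'Walk E lab t u v vs' : vs = u ∷ … ∷ v is a walk from u to v along
-- E-edges whose labels are non-decreasing and all at least t.

data Walk {V : Set} (E : V → V → Set) (lab : V → V → ℕ)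
          : ℕ → V → V → List V → Set where
  here : ∀ {t v} → Walk E lab t v v (v ∷ [])
  step : ∀ {t u w v vs} → E u w → t ≤ lab u w →
         Walk E lab (lab u w) w v vs → Walk E lab t u v (u ∷ vs)

TemporalPath : {V : Set} (E : V → V → Set) (lab : V → V → ℕ) → V → V → Set
TemporalPath E lab u v = ∃[ vs ] (Walk E lab 0 u v vs × Unique vs)

-- Temporal cliques on vertex set Fin n.
-- λ assigns a label to every unordered pair {u,v}, u ≢ v; we represent
-- it by a symmetric function (values on the diagonal are irrelevant).

record TemporalClique (n : ℕ) : Set where
  field
    lab  : Fin n → Fin n → ℕ
    symm : ∀ u v → lab u v ≡ lab v u

-- An edge set is given as a list of (ordered representatives of)
-- edges; its number of edges is bounded by the length of the list.
-- Edge {u,w} belongs to S iff (u,w) or (w,u) is listed.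
InS : {n : ℕ} → List (Fin n × Fin n) → Fin n → Fin n → Set
InS S u w = ((u , w) ∈ S) ⊎ ((w , u) ∈ S)

IsSpanner : {n : ℕ} → TemporalClique n → List (Fin n × Fin n) → Set
IsSpanner {n} G S =
  All (λ e → Data.Product.proj₁ e ≢ Data.Product.proj₂ e) S ×
  (∀ (u v : Fin n) → u ≢ v → TemporalPath (InS S) (TemporalClique.lab G) u v)

SpannerBound : ℕ → ℕ → Set
SpannerBound n k = ∀ (G : TemporalClique n) →
  ∃[ S ] (IsSpanner G S × length S ≤ k)

-- Temporal bi-cliques with parts A = Fin n (inj₁) and B = Fin n (inj₂).
-- λ a b is the label of the edge {a,b}, a ∈ A, b ∈ B.

TemporalBiClique : ℕ → Set
TemporalBiClique n = Fin n → Fin n → ℕ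

BiVertex : ℕ → Set
BiVertex n = Fin n ⊎ Fin n

-- labelling on the bipartite vertex set (value on non-edges irrelevant)
biLab : {n : ℕ} → TemporalBiClique n → BiVertex n → BiVertex n → ℕ
biLab G (inj₁ a) (inj₂ b) = G a b
biLab G (inj₂ b) (inj₁ a) = G a b
biLab G _ _ = 0

InBiS : {n : ℕ} → List (Fin n × Fin n) → BiVertex n → BiVertex n → Set
InBiS S (inj₁ a) (inj₂ b) = (a , b) ∈ S
InBiS S (inj₂ b) (inj₁ a) = (a , b) ∈ S
InBiS S _ _ = ⊥

IsBiSpanner : {n : ℕ} → TemporalBiClique n → List (Fin n × Fin n) → Set
IsBiSpanner {n} G S = ∀ (a b : Fin n) →
  TemporalPath (InBiS S) (biLab G) (inj₁ a) (inj₂ b)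

BiSpannerBound : ℕ → ℕ → Set
BiSpannerBound n k = ∀ (G : TemporalBiClique n) →
  ∃[ S ] (IsBiSpanner G S × length S ≤ k)

IsLeast : (ℕ → Set) → ℕ → Set
IsLeast P m = P m × (∀ k → P k → m ≤ k)

-- Read a temporal clique G as the bi-clique on two copies of its vertex set,
-- with the edge {a, b'} labelled λ{a,b}.  Identifying the two copies maps a
-- temporal path of a bi-spanner S onto a temporal walk of G along the edges
-- of S, except that edges {a, a'} collapse to a single vertex and are simply
-- skipped; shortcutting repeated vertices turns that walk into a temporal
-- path.  So the non-loop edges of S form a spanner of G with at most |S|
-- edges: every bi-spanner bound is a spanner bound, and s(n) ≤ b(n).
module Submission where

open import Defs
open import Data.Nat using (ℕ; _≤_)
open import Data.Nat.Properties using (≤-trans; ≤-refl)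
open import Data.Fin using (Fin)
open import Data.Fin.Properties using (_≟_)
open import Data.Product using (_×_; _,_; ∃-syntax; proj₁; proj₂)
open import Data.Sum using (_⊎_; inj₁; inj₂; reduce)
open import Data.List using (_∷_; filter)
open import Data.List.Properties using (length-filter)
open import Data.List.Membership.Propositional using (_∈_)
open import Data.List.Membership.Propositional.Properties using (∈-filter⁺)
open import Data.List.Relation.Unary.Any using (here; there; any?)
open import Data.List.Relation.Unary.All using ([])
open import Data.List.Relation.Unary.All.Properties using (all-filter; ¬Any⇒All¬)
open import Data.List.Relation.Unary.AllPairs using ([]; _∷_)
open import Data.List.Relation.Unary.Unique.Propositional using (Unique)
open import Relation.Binary.Definitions using (DecidableEquality)
open import Relation.Binary.PropositionalEquality using (_≡_; _≢_; refl; sym; subst)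
open import Relation.Nullary using (yes; no; ¬?)
open import Relation.Unary using (Decidable)

module _ {V : Set} {E : V → V → Set} {lab : V → V → ℕ} where

  Walk-weaken : ∀ {t t′ u v vs} → t′ ≤ t → Walk E lab t u v vs → Walk E lab t′ u v vs
  Walk-weaken t′≤t here           = here
  Walk-weaken t′≤t (step e t≤ℓ w) = step e (≤-trans t′≤t t≤ℓ) w

  Walk-suffix : ∀ {t u x v vs} → Walk E lab t u v vs → Unique vs → x ∈ vs →
                ∃[ t′ ] ∃[ ws ] (t ≤ t′ × Walk E lab t′ x v ws × Unique ws)
  Walk-suffix here            uniq       (here refl) = _ , _ , ≤-refl , here , uniq
  Walk-suffix here            _          (there ())
  Walk-suffix w@(step _ _ _)  uniq       (here refl) = _ , _ , ≤-refl , w , uniq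
  Walk-suffix (step e t≤ℓ w) (_ ∷ uniq) (there x∈vs) with Walk-suffix w uniq x∈vs
  ... | t′ , ws , ℓ≤t′ , w′ , uniq′ = t′ , ws , ≤-trans t≤ℓ ℓ≤t′ , w′ , uniq′

  -- A repeated vertex is removed by jumping to the rest of the walk after
  -- its later occurrence; the labels there are only larger, so the walk
  -- stays temporal.
  Walk-shortcut : DecidableEquality V → ∀ {t u v vs} → Walk E lab t u v vs →
                  ∃[ ws ] (Walk E lab t u v ws × Unique ws)
  Walk-shortcut _≟V_ here = _ , here , [] ∷ []
  Walk-shortcut _≟V_ {u = u} (step e t≤ℓ w) with Walk-shortcut _≟V_ w
  ... | ws , w′ , uniq with any? (u ≟V_) ws
  ...   | no u∉ws = u ∷ ws , step e t≤ℓ w′ , ¬Any⇒All¬ ws u∉ws ∷ uniq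
  ...   | yes u∈ws with Walk-suffix w′ uniq u∈ws
  ...     | _ , ws′ , ℓ≤t′ , w″ , uniq′ = ws′ , Walk-weaken (≤-trans t≤ℓ ℓ≤t′) w″ , uniq′

Walk-map : ∀ {V W : Set} {E : V → V → Set} {lab : V → V → ℕ}
             {F : W → W → Set} {lab′ : W → W → ℕ} (f : V → W) →
           (∀ {u w} → E u w → f u ≡ f w ⊎ (F (f u) (f w) × lab′ (f u) (f w) ≡ lab u w)) →
           ∀ {t u v vs} → Walk E lab t u v vs → ∃[ ws ] Walk F lab′ t (f u) (f v) ws
Walk-map f edge here = _ , here
Walk-map {F = F} {lab′} f edge {v = v} (step {u = u} {w} e t≤ℓ walk)
  with Walk-map f edge walk | edge e
... | ws , walk′ | inj₁ fu≡fw =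
  ws , subst (λ x → Walk F lab′ _ x (f v) ws) (sym fu≡fw) (Walk-weaken t≤ℓ walk′)
... | ws , walk′ | inj₂ (e′ , ℓ′≡ℓ) =
  _ , step e′ (subst (_ ≤_) (sym ℓ′≡ℓ) t≤ℓ)
               (subst (λ t → Walk F lab′ t (f w) (f v) ws) (sym ℓ′≡ℓ) walk′)

module _ {n : ℕ} (G : TemporalClique n) where
  open TemporalClique G

  asBiClique : TemporalBiClique n
  asBiClique = lab

  nonLoop? : Decidable {A = Fin n × Fin n} (λ (a , b) → a ≢ b)
  nonLoop? (a , b) = ¬? (a ≟ b)

  biEdge-reduce : ∀ S {x y} → InBiS S x y →
                  reduce x ≡ reduce y ⊎
                  (InS (filter nonLoop? S) (reduce x) (reduce y) ×
                   lab (reduce x) (reduce y) ≡ biLab asBiClique x y)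
  biEdge-reduce S {inj₁ a} {inj₂ b} ab∈S with a ≟ b
  ... | yes a≡b = inj₁ a≡b
  ... | no  a≢b = inj₂ (inj₁ (∈-filter⁺ nonLoop? ab∈S a≢b) , refl)
  biEdge-reduce S {inj₂ b} {inj₁ a} ab∈S with a ≟ b
  ... | yes a≡b = inj₁ (sym a≡b)
  ... | no  a≢b = inj₂ (inj₂ (∈-filter⁺ nonLoop? ab∈S a≢b) , symm b a)

  biSpanner⇒spanner : ∀ {S} → IsBiSpanner asBiClique S → IsSpanner G (filter nonLoop? S)
  biSpanner⇒spanner {S} biSpanner = all-filter nonLoop? S , path
    where
    path : ∀ u v → u ≢ v → TemporalPath (InS (filter nonLoop? S)) lab u v
    path u v _ = Walk-shortcut _≟_ (proj₂ (Walk-map reduce (biEdge-reduce S)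
                                                    (proj₁ (proj₂ (biSpanner u v)))))

biSpannerBound⇒spannerBound : ∀ {n k} → BiSpannerBound n k → SpannerBound n k
biSpannerBound⇒spannerBound bound G with bound (asBiClique G)
... | S , biSpanner , |S|≤k =
  filter (nonLoop? G) S , biSpanner⇒spanner G biSpanner ,
  ≤-trans (length-filter (nonLoop? G) S) |S|≤k

theorem6 : ∀ (n s b : ℕ) →
    IsLeast (SpannerBound n) s → IsLeast (BiSpannerBound n) b → s ≤ b
theorem6 n s b (_ , s-least) (b-bound , _) = s-least b (biSpannerBound⇒spannerBound b-bound)
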